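{- Every quasi 4-connected graph $G$ has a star-decomposition of adhesion three whose central torso is internally 4-connected or isomorphic to $K_4$ or $K_3$, and all of whose leaf-bags have exactly four vertices.
   Context: All graphs are finite and simple. A separation of $G$ is a set $\{A,B\}$ with $A\cup B=V(G)$ and no edge between $A\setminus B$ and $B\setminus A$; its order is $|A\cap B|$. A graph $G$ is quasi 4-connected if it is 3-connected, has more than four vertices, and every separation of order 3 of $G$ has a side with at most four vertices. A graph is internally 4-connected if it is 3-connected, has more than four vertices, and for every 3-set $S$ with $G-S$ disconnected, $S$ is independent and $G-S$ has exactly two components, one a single vertex. A star-decomposition is a tree-decomposition $(T,(V_t)_{t\in V(T)})$ whose tree $T$ is a star $K_{1,n}$ ($n\ge 0$) with a designated centre; the bag of the centre is the central bag and the other bags are leaf-bags. It has adhesion three if every intersection $V_t\cap V_{t'}$ for adjacent $t,t'$ has (at most) three vertices. The torso of a bag $V_t$ is the graph obtained from $G[V_t]$ by making every set $V_t\cap V_{t'}$, for $t'$ adjacent to $t$, a clique. -}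

module Defs where

open import Data.Nat using (ℕ; _≤_; _<_)
open import Data.Bool using (Bool; T)
open import Data.Fin using (Fin)
open import Data.Fin.Subset using (Subset; _∈_; _∉_; _⊆_; _∩_; _∪_; _─_; _-_; ⊤; ∣_∣)
open import Data.Product using (Σ; _×_; ∃; ∃-syntax)
open import Data.Sum using (_⊎_)
open import Relation.Nullary using (¬_)
open import Relation.Binary.PropositionalEquality using (_≡_; _≢_)
open import Function using (Injective)

record Graph : Set where
  field
    n     : ℕ
    adj   : Fin n → Fin n → Bool
    sym   : ∀ u v → T (adj u v) → T (adj v u)
    irref : ∀ v → ¬ T (adj v v)

-- A "graph on a vertex subset": vertex set U ⊆ Fin n together with an
-- adjacency relation E (only its restriction to U matters).  Used for G
-- itself (U = ⊤), for subgraphs G - X, and for torsos.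
record SGraph (n : ℕ) : Set₁ where
  constructor sg
  field
    V : Subset n
    E : Fin n → Fin n → Set
open SGraph public

toSG : (G : Graph) → SGraph (Graph.n G)
toSG G = sg ⊤ (λ u v → T (Graph.adj G u v))

module _ {n : ℕ} where

  data Walk (H : SGraph n) : Fin n → Fin n → Set where
    here : ∀ {u} → u ∈ V H → Walk H u u
    step : ∀ {u v w} → u ∈ V H → E H u v → Walk H v w → Walk H u w

  Connected : SGraph n → Set
  Connected H = ∀ u v → u ∈ V H → v ∈ V H → Walk H u v

  _∖_ : SGraph n → Subset n → SGraph n
  H ∖ X = sg (V H ─ X) (E H)

  KConnected : ℕ → SGraph n → Set
  KConnected k H = k < ∣ V H ∣ × (∀ X → X ⊆ V H → ∣ X ∣ < k → Connected (H ∖ X))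

  IsSeparation : SGraph n → Subset n → Subset n → Set
  IsSeparation H A B =
    (A ∪ B ≡ V H) × (∀ u v → u ∈ A ─ B → v ∈ B ─ A → ¬ E H u v)

  Quasi4Connected : SGraph n → Set
  Quasi4Connected H =
    KConnected 3 H × 4 < ∣ V H ∣ ×
    (∀ A B → IsSeparation H A B → ∣ A ∩ B ∣ ≡ 3 → ∣ A ∣ ≤ 4 ⊎ ∣ B ∣ ≤ 4)

  Independent : SGraph n → Subset n → Set
  Independent H S = ∀ u v → u ∈ S → v ∈ S → ¬ E H u v

  -- "H - S has exactly two components, one of them a single vertex":
  -- there is a vertex x of H - S all of whose neighbours in H lie in S
  -- (so {x} is a component) and (H - S) - x is connected (the other component).
  TwoComponentsOneTrivial : SGraph n → Subset n → Set
  TwoComponentsOneTrivial H S =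
    ∃[ x ] (x ∈ V H ─ S × (∀ w → w ∈ V H → E H x w → w ∈ S)
            × Connected (sg ((V H ─ S) - x) (E H)))

  Internally4Connected : SGraph n → Set
  Internally4Connected H =
    KConnected 3 H × 4 < ∣ V H ∣ ×
    (∀ S → S ⊆ V H → ∣ S ∣ ≡ 3 → ¬ Connected (H ∖ S) →
       Independent H S × TwoComponentsOneTrivial H S)

  IsoToComplete : ℕ → SGraph n → Set
  IsoToComplete k H =
    Σ (Fin k → Fin n) λ f →
      Injective _≡_ _≡_ f × (∀ i → f i ∈ V H) × (∀ u → u ∈ V H → ∃[ i ] f i ≡ u)
      × (∀ i j → (i ≢ j → E H (f i) (f j)) × (E H (f i) (f j) → i ≢ j))

-- A star-decomposition: tree K_{1,m} with centre bag and m leaf bags,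
-- satisfying the tree-decomposition axioms (for a star, (T3) says a vertex
-- lying in two distinct leaf bags lies in the central bag).
record StarDecomposition (G : Graph) : Set where
  field
    m       : ℕ
    centre  : Subset (Graph.n G)
    leaf    : Fin m → Subset (Graph.n G)
    covers  : ∀ v → v ∈ centre ⊎ ∃[ i ] v ∈ leaf i
    edges   : ∀ u v → T (Graph.adj G u v) →
                (u ∈ centre × v ∈ centre) ⊎ ∃[ i ] (u ∈ leaf i × v ∈ leaf i)
    coherent : ∀ v i j → i ≢ j → v ∈ leaf i → v ∈ leaf j → v ∈ centre

module _ {G : Graph} (D : StarDecomposition G) where
  open StarDecomposition D

  AdhesionThree : Set
  AdhesionThree = ∀ i → ∣ centre ∩ leaf i ∣ ≤ 3

  centralTorso : SGraph (Graph.n G)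
  centralTorso = sg centre (λ u v → T (Graph.adj G u v)
                    ⊎ (u ≢ v × ∃[ i ] (u ∈ centre ∩ leaf i × v ∈ centre ∩ leaf i)))

module Submission where

-- Let I be a maximal independent set of degree-3 vertices.  The closed neighbourhoods of
-- the vertices of I are the leaf-bags (four vertices each, meeting the centre ∁ I in three),
-- and walks through I shortcut to torso edges, so the torso inherits 3-connectivity.  If a
-- 3-set S ⊆ ∁ I separated the torso, it would separate G, and quasi 4-connectivity would
-- leave a side consisting of S and one vertex z ∈ ∁ I with all its neighbours in S.  Then z
-- has degree 3 and no neighbour in I, contradicting maximality.  Hence the torso has no
-- 3-separator at all when it has five or more vertices; otherwise it has three or four
-- vertices and no separator of size below three, so it is complete.

open import Defs
open import Data.Nat using (ℕ; zero; suc; _≤_; _<_; z≤n; s≤s; _≤?_)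
open import Data.Nat.Properties
  using (≤-trans; ≤-antisym; ≤-pred; ≰⇒>; <⇒≱; <⇒≤; ≤∧≢⇒<)
  renaming (_≟_ to _≟ℕ_)
open import Data.Bool using (Bool; true; false; T)
open import Data.Bool.Properties using (T-≡)
open import Data.Fin using (Fin; zero; suc)
open import Data.Fin.Properties using (any?; all?; ¬∀⟶∃¬; suc-injective; ¬Fin0; _≟_)
open import Data.Fin.Subset
open import Data.Fin.Subset.Properties
open import Data.Vec using ([]; _∷_; tabulate; here; there)
open import Data.Vec.Properties using (lookup∘tabulate; []=⇒lookup; lookup⇒[]=)
open import Data.List using (List; []; _∷_; allFin)
open import Data.List.Membership.Propositional using () renaming (_∈_ to _∈ˡ_)
open import Data.List.Membership.Propositional.Properties using (∈-allFin)
import Data.List.Relation.Unary.Any as Any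
open import Data.Product using (Σ; _×_; _,_; proj₁; proj₂; ∃-syntax)
open import Data.Sum using (_⊎_; inj₁; inj₂; [_,_]′)
open import Data.Empty using (⊥-elim)
open import Function using (Injective; _∘_; Equivalence)
open import Relation.Nullary using (¬_; Dec; yes; no; contradiction)
open import Relation.Nullary.Decidable using (¬¬-excluded-middle; isYes; toWitness; fromWitness)
open import Relation.Binary.PropositionalEquality
  using (_≡_; _≢_; refl; sym; trans; cong; subst)

private
  variable
    n k : ℕ

x∈p─q⁻ : ∀ (p q : Subset n) {x} → x ∈ p ─ q → x ∈ p × x ∉ q
x∈p─q⁻ (_ ∷ p) (true  ∷ q) (there x∈) with x∈p─q⁻ p q x∈
... | x∈p , x∉q = there x∈p , λ { (there x∈q) → x∉q x∈q }
x∈p─q⁻ (_ ∷ p) (false ∷ q) here = here , λ ()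
x∈p─q⁻ (_ ∷ p) (false ∷ q) (there x∈) with x∈p─q⁻ p q x∈
... | x∈p , x∉q = there x∈p , λ { (there x∈q) → x∉q x∈q }

x∈tabulate⁺ : ∀ (f : Fin n → Bool) {x} → T (f x) → x ∈ tabulate f
x∈tabulate⁺ f {x} t =
  lookup⇒[]= x (tabulate f) (trans (lookup∘tabulate f x) (Equivalence.to T-≡ t))

x∈tabulate⁻ : ∀ (f : Fin n → Bool) {x} → x ∈ tabulate f → T (f x)
x∈tabulate⁻ f {x} x∈ =
  Equivalence.from T-≡ (trans (sym (lookup∘tabulate f x)) ([]=⇒lookup x∈))

∣p∪⊥∣≡∣p∣ : ∀ (p : Subset n) → ∣ p ∪ ⊥ ∣ ≡ ∣ p ∣
∣p∪⊥∣≡∣p∣ []          = refl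
∣p∪⊥∣≡∣p∣ (true  ∷ p) = cong suc (∣p∪⊥∣≡∣p∣ p)
∣p∪⊥∣≡∣p∣ (false ∷ p) = ∣p∪⊥∣≡∣p∣ p

x∉p⇒∣p∪⁅x⁆∣≡1+∣p∣ : ∀ (p : Subset n) x → x ∉ p → ∣ p ∪ ⁅ x ⁆ ∣ ≡ suc ∣ p ∣
x∉p⇒∣p∪⁅x⁆∣≡1+∣p∣ (true  ∷ p) zero    x∉p = contradiction here x∉p
x∉p⇒∣p∪⁅x⁆∣≡1+∣p∣ (false ∷ p) zero    x∉p = cong suc (∣p∪⊥∣≡∣p∣ p)
x∉p⇒∣p∪⁅x⁆∣≡1+∣p∣ (true  ∷ p) (suc x) x∉p = cong suc (x∉p⇒∣p∪⁅x⁆∣≡1+∣p∣ p x (x∉p ∘ there))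
x∉p⇒∣p∪⁅x⁆∣≡1+∣p∣ (false ∷ p) (suc x) x∉p = x∉p⇒∣p∪⁅x⁆∣≡1+∣p∣ p x (x∉p ∘ there)

x∈p∪⁅y⁆⁻ : ∀ (p : Subset n) {x} y → x ∈ p ∪ ⁅ y ⁆ → x ∈ p ⊎ x ≡ y
x∈p∪⁅y⁆⁻ p y x∈ with x∈p∪q⁻ p ⁅ y ⁆ x∈
... | inj₁ x∈p = inj₁ x∈p
... | inj₂ x∈y = inj₂ (x∈⁅y⁆⇒x≡y y x∈y)

y∈p∪⁅y⁆ : ∀ (p : Subset n) y → y ∈ p ∪ ⁅ y ⁆
y∈p∪⁅y⁆ p y = x∈p∪q⁺ {p = p} (inj₂ (x∈⁅x⁆ y))

∣p∣<n⇒∃x∉p : ∀ (p : Subset n) → ∣ p ∣ < n → ∃[ x ] x ∉ p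
∣p∣<n⇒∃x∉p {n} p ∣p∣<n with all? (_∈? p)
... | yes ⊤⊆p = contradiction (subst (_≤ ∣ p ∣) (∣⊤∣≡n n) (p⊆q⇒∣p∣≤∣q∣ {p = ⊤} λ {x} _ → ⊤⊆p x))
                            (<⇒≱ ∣p∣<n)
... | no ⊤⊈p = ¬∀⟶∃¬ n _ (_∈? p) ⊤⊈p

two-in-q─p⇒2+∣p∣≤∣q∣ : ∀ {p q : Subset n} {a b} → p ⊆ q → a ∈ q ─ p → b ∈ q ─ p → a ≢ b →
                         suc (suc ∣ p ∣) ≤ ∣ q ∣
two-in-q─p⇒2+∣p∣≤∣q∣ {p = p} {q} {a} {b} p⊆q a∈ b∈ a≢b =
  subst (_≤ ∣ q ∣) size (p⊆q⇒∣p∣≤∣q∣ ⊆q)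
  where
  b∉p∪a : b ∉ p ∪ ⁅ a ⁆
  b∉p∪a b∈p∪a with x∈p∪⁅y⁆⁻ p a b∈p∪a
  ... | inj₁ b∈p = proj₂ (x∈p─q⁻ q p b∈) b∈p
  ... | inj₂ b≡a = a≢b (sym b≡a)
  size : ∣ (p ∪ ⁅ a ⁆) ∪ ⁅ b ⁆ ∣ ≡ suc (suc ∣ p ∣)
  size = trans (x∉p⇒∣p∪⁅x⁆∣≡1+∣p∣ (p ∪ ⁅ a ⁆) b b∉p∪a)
               (cong suc (x∉p⇒∣p∪⁅x⁆∣≡1+∣p∣ p a (proj₂ (x∈p─q⁻ q p a∈))))
  ⊆q : (p ∪ ⁅ a ⁆) ∪ ⁅ b ⁆ ⊆ q
  ⊆q x∈ with x∈p∪⁅y⁆⁻ (p ∪ ⁅ a ⁆) b x∈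
  ... | inj₂ refl = proj₁ (x∈p─q⁻ q p b∈)
  ... | inj₁ x∈p∪a with x∈p∪⁅y⁆⁻ p a x∈p∪a
  ...   | inj₁ x∈p = p⊆q x∈p
  ...   | inj₂ refl = proj₁ (x∈p─q⁻ q p a∈)

∣q∣≤1+∣p∣⇒unique-in-q─p : ∀ {p q : Subset n} {a b} → ∣ q ∣ ≤ suc ∣ p ∣ → p ⊆ q →
                           a ∈ q ─ p → b ∈ q ─ p → a ≡ b
∣q∣≤1+∣p∣⇒unique-in-q─p {a = a} {b} ∣q∣≤ p⊆q a∈ b∈ with a ≟ b
... | yes a≡b = a≡b
... | no  a≢b = contradiction ∣q∣≤ (<⇒≱ (two-in-q─p⇒2+∣p∣≤∣q∣ p⊆q a∈ b∈ a≢b))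

Enumeration : ℕ → Subset n → Set
Enumeration {n} k p =
  Σ (Fin k → Fin n) λ f →
    Injective _≡_ _≡_ f × (∀ i → f i ∈ p) × (∀ x → x ∈ p → ∃[ i ] f i ≡ x)

enumerate : ∀ (p : Subset n) → Enumeration ∣ p ∣ p
enumerate [] = (λ ()) , (λ {i} _ → ⊥-elim (¬Fin0 i)) , (λ ()) , λ _ ()
enumerate (false ∷ p) with enumerate p
... | f , f-inj , f∈p , onto =
  suc ∘ f , f-inj ∘ suc-injective , there ∘ f∈p , λ where
    (suc x) (there x∈p) → let i , fi≡x = onto x x∈p in i , cong suc fi≡x
enumerate (true ∷ p) with enumerate p
... | f , f-inj , f∈p , onto = g , g-inj , g∈ , g-onto
  where
  g : Fin (suc ∣ p ∣) → Fin _
  g zero    = zero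
  g (suc i) = suc (f i)
  g-inj : Injective _≡_ _≡_ g
  g-inj {zero}  {zero}  _ = refl
  g-inj {suc i} {suc j} e = cong suc (f-inj (suc-injective e))
  g∈ : ∀ i → g i ∈ true ∷ p
  g∈ zero    = here
  g∈ (suc i) = there (f∈p i)
  g-onto : ∀ x → x ∈ true ∷ p → ∃[ i ] g i ≡ x
  g-onto zero    _           = zero , refl
  g-onto (suc x) (there x∈p) = let i , fi≡x = onto x x∈p in suc i , cong suc fi≡x

enumerate-of-size : ∀ (p : Subset n) → ∣ p ∣ ≡ k → Enumeration k p
enumerate-of-size p refl = enumerate p

¬¬-∀ : ∀ {P : Fin n → Set} → (∀ i → ¬ ¬ P i) → ¬ ¬ (∀ i → P i)
¬¬-∀ {zero}  _  ¬∀ = ¬∀ λ ()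
¬¬-∀ {suc n} ¬¬P ¬∀ = ¬¬P zero λ P0 → ¬¬-∀ (¬¬P ∘ suc) λ P∘suc → ¬∀ λ where
  zero    → P0
  (suc i) → P∘suc i

¬¬-decidable : ∀ {R : Fin n → Fin n → Set} → ¬ ¬ (∀ u v → Dec (R u v))
¬¬-decidable = ¬¬-∀ λ _ → ¬¬-∀ λ _ → ¬¬-excluded-middle

module _ {H : SGraph n} where

  walk-source : ∀ {u v} → Walk H u v → u ∈ V H
  walk-source (here u∈)     = u∈
  walk-source (step u∈ _ _) = u∈

  walk-target : ∀ {u v} → Walk H u v → v ∈ V H
  walk-target (here v∈)    = v∈
  walk-target (step _ _ r) = walk-target r

  walk-snoc : ∀ {u v w} → Walk H u v → E H v w → w ∈ V H → Walk H u w
  walk-snoc (here v∈)      e w∈ = step v∈ e (here w∈)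
  walk-snoc (step u∈ e′ r) e w∈ = step u∈ e′ (walk-snoc r e w∈)

  walk-within-pair⇒edge : ∀ {u v} → u ≢ v → (∀ y → y ∈ V H → y ≡ u ⊎ y ≡ v) →
                          Walk H u v → E H u v
  walk-within-pair⇒edge u≢v _    (here _) = ⊥-elim (u≢v refl)
  walk-within-pair⇒edge u≢v pair (step _ e r) with pair _ (walk-source r)
  ... | inj₁ refl = walk-within-pair⇒edge u≢v pair r
  ... | inj₂ refl = e

NoSeparatorSmallerThan : ℕ → SGraph n → Set
NoSeparatorSmallerThan k H = ∀ X → X ⊆ V H → ∣ X ∣ < k → Connected (H ∖ X)

module _ {H : SGraph n} where

  no-small-separator⇒complete : NoSeparatorSmallerThan k H → ∣ V H ∣ ≤ suc k →
                                ∀ u v → u ∈ V H → v ∈ V H → u ≢ v → E H u v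
  no-small-separator⇒complete {k} unsep ∣H∣≤ u v u∈ v∈ u≢v =
    walk-within-pair⇒edge u≢v only-u-v
      (unsep X (p─q⊆p (V H) uv) ∣X∣<k u v (∈V∖X u∈ u∈uv) (∈V∖X v∈ v∈uv))
    where
    uv X : Subset _
    uv = ⁅ u ⁆ ∪ ⁅ v ⁆
    X  = V H ─ uv
    u∈uv : u ∈ uv
    u∈uv = x∈p∪q⁺ {p = ⁅ u ⁆} (inj₁ (x∈⁅x⁆ u))
    v∈uv : v ∈ uv
    v∈uv = y∈p∪⁅y⁆ ⁅ u ⁆ v
    ∈V∖X : ∀ {y} → y ∈ V H → y ∈ uv → y ∈ V H ─ X
    ∈V∖X y∈ y∈uv = x∈p∧x∉q⇒x∈p─q y∈ λ y∈X → proj₂ (x∈p─q⁻ (V H) uv y∈X) y∈uv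
    ∣X∣<k : ∣ X ∣ < k
    ∣X∣<k = ≤-pred (≤-trans (two-in-q─p⇒2+∣p∣≤∣q∣ (p─q⊆p (V H) uv)
                              (∈V∖X u∈ u∈uv) (∈V∖X v∈ v∈uv) u≢v) ∣H∣≤)
    only-u-v : ∀ y → y ∈ V (H ∖ X) → y ≡ u ⊎ y ≡ v
    only-u-v y y∈ with x∈p─q⁻ (V H) X y∈
    ... | y∈H , y∉X with y ∈? uv
    ...   | no y∉uv = contradiction (x∈p∧x∉q⇒x∈p─q y∈H y∉uv) y∉X
    ...   | yes y∈uv with x∈p∪⁅y⁆⁻ ⁅ u ⁆ v y∈uv
    ...     | inj₁ y∈u = inj₁ (x∈⁅y⁆⇒x≡y u y∈u)
    ...     | inj₂ y≡v = inj₂ y≡v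

  complete⇒IsoToComplete : ∣ V H ∣ ≡ k → (∀ u → ¬ E H u u) →
                           (∀ u v → u ∈ V H → v ∈ V H → u ≢ v → E H u v) → IsoToComplete k H
  complete⇒IsoToComplete ∣H∣≡k irreflexive complete with enumerate-of-size (V H) ∣H∣≡k
  ... | f , f-inj , f∈ , onto = f , f-inj , f∈ , onto , λ i j →
    (λ i≢j → complete (f i) (f j) (f∈ i) (f∈ j) (i≢j ∘ f-inj)) ,
    (λ { e refl → irreflexive (f i) e })

module Neighbourhood (G : Graph) where
  open Graph G public using (adj) renaming (n to order; sym to Adj-sym; irref to Adj-irrefl)

  Adj : Fin order → Fin order → Set
  Adj u v = T (adj u v)

  N : Fin order → Subset order
  N x = tabulate (adj x)

  N[_] : Fin order → Subset order
  N[ x ] = N x ∪ ⁅ x ⁆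

  deg : Fin order → ℕ
  deg x = ∣ N x ∣

  N⁺ : ∀ {x w} → Adj x w → w ∈ N x
  N⁺ {x} = x∈tabulate⁺ (adj x)

  N⁻ : ∀ {x w} → w ∈ N x → Adj x w
  N⁻ {x} = x∈tabulate⁻ (adj x)

  Adj⇒≢ : ∀ {u v} → Adj u v → u ≢ v
  Adj⇒≢ {u} e refl = Adj-irrefl u e

  x∉Nx : ∀ x → x ∉ N x
  x∉Nx x x∈ = Adj-irrefl x (N⁻ x∈)

  ∣N[x]∣≡1+deg : ∀ x → ∣ N[ x ] ∣ ≡ suc (deg x)
  ∣N[x]∣≡1+deg x = x∉p⇒∣p∪⁅x⁆∣≡1+∣p∣ (N x) x (x∉Nx x)

  ∉⇒∈G∖ : ∀ {X : Subset order} {x} → x ∉ X → x ∈ V (toSG G ∖ X)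
  ∉⇒∈G∖ = x∈p∧x∉q⇒x∈p─q ∈⊤

  KConnected⇒k≤deg : KConnected k (toSG G) → ∀ x → k ≤ deg x
  KConnected⇒k≤deg {k} (k<∣G∣ , unsep) x with k ≤? deg x
  ... | yes k≤deg = k≤deg
  ... | no  k≰deg = contradiction (∣p∣<n⇒∃x∉p N[ x ] ∣N[x]∣<order) escapes
    where
    deg<k : deg x < k
    deg<k = ≰⇒> k≰deg
    ∣N[x]∣<order : ∣ N[ x ] ∣ < order
    ∣N[x]∣<order = subst (_< order) (sym (∣N[x]∣≡1+deg x))
                         (≤-trans (s≤s deg<k) (subst (k <_) (∣⊤∣≡n order) k<∣G∣))
    stuck : ∀ {w} → w ∉ N[ x ] → ¬ Walk (toSG G ∖ N x) x w
    stuck x∉N[x] (here _)     = x∉N[x] (y∈p∪⁅y⁆ (N x) x)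
    stuck _      (step _ e r) = proj₂ (x∈p─q⁻ ⊤ (N x) (walk-source r)) (N⁺ e)
    escapes : ¬ (∃[ w ] w ∉ N[ x ])
    escapes (w , w∉N[x]) = stuck w∉N[x]
      (unsep (N x) ⊆⊤ deg<k x w (∉⇒∈G∖ (x∉Nx x)) (∉⇒∈G∖ (w∉N[x] ∘ x∈p∪q⁺ ∘ inj₁)))

module ReachableSeparation (G : Graph) {S : Subset (Graph.n G)} {u : Fin (Graph.n G)}
                           (reach? : ∀ w → Dec (Walk (toSG G ∖ S) u w)) where
  open Neighbourhood G

  K : Subset order
  K = tabulate (isYes ∘ reach?)

  K⁺ : ∀ {w} → Walk (toSG G ∖ S) u w → w ∈ K
  K⁺ r = x∈tabulate⁺ (isYes ∘ reach?) (fromWitness r)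

  K⁻ : ∀ {w} → w ∈ K → Walk (toSG G ∖ S) u w
  K⁻ w∈K = toWitness (x∈tabulate⁻ (isYes ∘ reach?) w∈K)

  K∌S : ∀ {w} → w ∈ K → w ∉ S
  K∌S w∈K = proj₂ (x∈p─q⁻ ⊤ S (walk-target (K⁻ w∈K)))

  separation : IsSeparation (toSG G) (K ∪ S) (∁ K)
  separation = covers , no-edge
    where
    covers : (K ∪ S) ∪ ∁ K ≡ ⊤
    covers = ⊆-antisym ⊆⊤ λ {w} _ → case (w ∈? K)
      where
      case : ∀ {w} → Dec (w ∈ K) → w ∈ (K ∪ S) ∪ ∁ K
      case (yes w∈K) = x∈p∪q⁺ (inj₁ (x∈p∪q⁺ (inj₁ w∈K)))
      case (no  w∉K) = x∈p∪q⁺ {p = K ∪ S} (inj₂ (x∉p⇒x∈∁p w∉K))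
    no-edge : ∀ a b → a ∈ (K ∪ S) ─ ∁ K → b ∈ ∁ K ─ (K ∪ S) → ¬ Adj a b
    no-edge a b a∈ b∈ e with x∈p─q⁻ (K ∪ S) (∁ K) a∈ | x∈p─q⁻ (∁ K) (K ∪ S) b∈
    ... | _ , a∉∁K | b∈∁K , b∉K∪S =
      x∈∁p⇒x∉p b∈∁K
        (K⁺ (walk-snoc (K⁻ (x∉∁p⇒x∈p a∉∁K)) e (∉⇒∈G∖ (b∉K∪S ∘ x∈p∪q⁺ ∘ inj₂))))

  separator : (K ∪ S) ∩ ∁ K ≡ S
  separator = ⊆-antisym ⊆S S⊆
    where
    ⊆S : (K ∪ S) ∩ ∁ K ⊆ S
    ⊆S w∈ with x∈p∩q⁻ (K ∪ S) (∁ K) w∈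
    ... | w∈K∪S , w∈∁K with x∈p∪q⁻ K S w∈K∪S
    ...   | inj₁ w∈K = contradiction w∈K (x∈∁p⇒x∉p w∈∁K)
    ...   | inj₂ w∈S = w∈S
    S⊆ : S ⊆ (K ∪ S) ∩ ∁ K
    S⊆ w∈S = x∈p∩q⁺ (x∈p∪q⁺ (inj₂ w∈S) , x∉p⇒x∈∁p λ w∈K → K∌S w∈K w∈S)

module QuasiFourConnected (G : Graph) (Q : Quasi4Connected (toSG G)) where
  open Neighbourhood G

  3≤deg : ∀ x → 3 ≤ deg x
  3≤deg = KConnected⇒k≤deg (proj₁ Q)

  N⊆3-set⇒deg≡3 : ∀ {S} x → ∣ S ∣ ≡ 3 → N x ⊆ S → deg x ≡ 3
  N⊆3-set⇒deg≡3 x ∣S∣≡3 N⊆S = ≤-antisym (subst (deg x ≤_) ∣S∣≡3 (p⊆q⇒∣p∣≤∣q∣ N⊆S)) (3≤deg x)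

  3-separator-isolates : ∀ {S u v} → ∣ S ∣ ≡ 3 → u ∉ S → v ∉ S →
                         (∀ w → Dec (Walk (toSG G ∖ S) u w)) → ¬ Walk (toSG G ∖ S) u v →
                         N u ⊆ S ⊎ N v ⊆ S
  3-separator-isolates {S} {u} {v} ∣S∣≡3 u∉S v∉S reach? u↛v =
    isolate (proj₂ (proj₂ Q) (K ∪ S) (∁ K) separation (trans (cong ∣_∣ separator) ∣S∣≡3))
    where
    open ReachableSeparation G reach?
    trapped : ∀ {P x} → ∣ P ∣ ≤ 4 → S ⊆ P → x ∈ P ─ S → (∀ {w} → Adj x w → w ∉ S → w ∈ P) →
              N x ⊆ S
    trapped {P} ∣P∣≤4 S⊆P x∈ stays {w} w∈N with w ∈? S
    ... | yes w∈S = w∈S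
    ... | no  w∉S = contradiction
      (∣q∣≤1+∣p∣⇒unique-in-q─p (subst (λ m → ∣ P ∣ ≤ suc m) (sym ∣S∣≡3) ∣P∣≤4) S⊆P x∈
                                 (x∈p∧x∉q⇒x∈p─q (stays (N⁻ w∈N) w∉S) w∉S))
      (Adj⇒≢ (N⁻ w∈N))
    isolate : ∣ K ∪ S ∣ ≤ 4 ⊎ ∣ ∁ K ∣ ≤ 4 → N u ⊆ S ⊎ N v ⊆ S
    isolate (inj₁ ∣K∪S∣≤4) = inj₁ (trapped ∣K∪S∣≤4 (x∈p∪q⁺ ∘ inj₂)
      (x∈p∧x∉q⇒x∈p─q (x∈p∪q⁺ (inj₁ (K⁺ (here (∉⇒∈G∖ u∉S))))) u∉S)
      λ e w∉S → x∈p∪q⁺ (inj₁ (K⁺ (step (∉⇒∈G∖ u∉S) e (here (∉⇒∈G∖ w∉S))))))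
    isolate (inj₂ ∣∁K∣≤4) = inj₂ (trapped ∣∁K∣≤4 (λ w∈S → x∉p⇒x∈∁p λ w∈K → K∌S w∈K w∈S)
      (x∈p∧x∉q⇒x∈p─q (x∉p⇒x∈∁p (u↛v ∘ K⁻)) v∉S)
      λ e w∉S → x∉p⇒x∈∁p λ w∈K → u↛v (walk-snoc (K⁻ w∈K) (Adj-sym _ _ e) (∉⇒∈G∖ v∉S)))

module GreedyIndependentSet (G : Graph) {P : Fin (Graph.n G) → Set} (P? : ∀ x → Dec (P x)) where
  open Neighbourhood G

  Dominated : Subset order → Fin order → Set
  Dominated I z = z ∈ I ⊎ ∃[ y ] (y ∈ I × Adj z y)

  record IndependentDominating (zs : List (Fin order)) : Set where
    field
      I           : Subset order
      I⊆P         : ∀ {x} → x ∈ I → P x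
      independent : Independent (toSG G) I
      dominates   : ∀ {z} → z ∈ˡ zs → P z → Dominated I z
  open IndependentDominating

  private
    keep : ∀ {zs z} (J : IndependentDominating zs) → (P z → Dominated (I J) z) →
           IndependentDominating (z ∷ zs)
    keep J new = record
      { I           = I J
      ; I⊆P         = I⊆P J
      ; independent = independent J
      ; dominates   = λ where
          (Any.here refl) → new
          (Any.there z∈)  → dominates J z∈
      }

    insert : ∀ {zs z} (J : IndependentDominating zs) → P z → ¬ (∃[ y ] y ∈ I J ∩ N z) →
             IndependentDominating (z ∷ zs)
    insert {z = z} J Pz free = record
      { I           = I J ∪ ⁅ z ⁆
      ; I⊆P         = I⊆P′
      ; independent = independent′
      ; dominates   = λ where
          (Any.here refl) _  → inj₁ (y∈p∪⁅y⁆ (I J) z)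
          (Any.there z′∈) Pz′ → grow (dominates J z′∈ Pz′)
      }
      where
      I⊆P′ : ∀ {x} → x ∈ I J ∪ ⁅ z ⁆ → P x
      I⊆P′ {x} x∈ with x∈p∪⁅y⁆⁻ (I J) z x∈
      ... | inj₁ x∈I = I⊆P J x∈I
      ... | inj₂ refl = Pz
      independent′ : Independent (toSG G) (I J ∪ ⁅ z ⁆)
      independent′ u v u∈ v∈ with x∈p∪⁅y⁆⁻ (I J) z u∈ | x∈p∪⁅y⁆⁻ (I J) z v∈
      ... | inj₁ u∈I  | inj₁ v∈I  = independent J u v u∈I v∈I
      ... | inj₂ refl | inj₁ v∈I  = λ e → free (v , x∈p∩q⁺ (v∈I , N⁺ e))
      ... | inj₁ u∈I  | inj₂ refl = λ e → free (u , x∈p∩q⁺ (u∈I , N⁺ (Adj-sym u v e)))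
      ... | inj₂ refl | inj₂ refl = Adj-irrefl u
      grow : ∀ {z′} → Dominated (I J) z′ → Dominated (I J ∪ ⁅ z ⁆) z′
      grow (inj₁ z′∈I)           = inj₁ (x∈p∪q⁺ (inj₁ z′∈I))
      grow (inj₂ (y , y∈I , e)) = inj₂ (y , x∈p∪q⁺ (inj₁ y∈I) , e)

    extend : ∀ {zs} z → IndependentDominating zs → IndependentDominating (z ∷ zs)
    extend z J with P? z | any? (λ y → y ∈? I J ∩ N z)
    ... | no ¬Pz | _                = keep J λ Pz → contradiction Pz ¬Pz
    ... | yes _  | yes (y , y∈I∩N) = let y∈I , y∈N = x∈p∩q⁻ (I J) (N z) y∈I∩N in
                                      keep J λ _ → inj₂ (y , y∈I , N⁻ y∈N)
    ... | yes Pz | no free          = insert J Pz free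

  greedy : ∀ zs → IndependentDominating zs
  greedy []       = record
    { I           = ⊥
    ; I⊆P         = λ x∈⊥ → contradiction x∈⊥ ∉⊥
    ; independent = λ _ _ u∈⊥ → contradiction u∈⊥ ∉⊥
    ; dominates   = λ ()
    }
  greedy (z ∷ zs) = extend z (greedy zs)

module StarOfIndependentSet (G : Graph) (I : Subset (Graph.n G))
                            (independent : Independent (toSG G) I) where
  open Neighbourhood G

  private
    enumeration : Enumeration ∣ I ∣ I
    enumeration = enumerate I

  member : Fin ∣ I ∣ → Fin order
  member = proj₁ enumeration

  member-injective : Injective _≡_ _≡_ member
  member-injective = proj₁ (proj₂ enumeration)

  member∈I : ∀ i → member i ∈ I
  member∈I = proj₁ (proj₂ (proj₂ enumeration))

  member-onto : ∀ x → x ∈ I → ∃[ i ] member i ≡ x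
  member-onto = proj₂ (proj₂ (proj₂ enumeration))

  N[x]⁺ : ∀ {x w} → Adj x w → w ∈ N[ x ]
  N[x]⁺ e = x∈p∪q⁺ (inj₁ (N⁺ e))

  star : StarDecomposition G
  star = record
    { m        = ∣ I ∣
    ; centre   = ∁ I
    ; leaf     = λ i → N[ member i ]
    ; covers   = covers
    ; edges    = edges
    ; coherent = coherent
    }
    where
    covers : ∀ v → v ∈ ∁ I ⊎ ∃[ i ] v ∈ N[ member i ]
    covers v with v ∈? I
    ... | no  v∉I = inj₁ (x∉p⇒x∈∁p v∉I)
    ... | yes v∈I with member-onto v v∈I
    ...   | i , refl = inj₂ (i , y∈p∪⁅y⁆ (N (member i)) (member i))
    edges : ∀ u v → Adj u v →
            (u ∈ ∁ I × v ∈ ∁ I) ⊎ ∃[ i ] (u ∈ N[ member i ] × v ∈ N[ member i ])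
    edges u v e with u ∈? I | v ∈? I
    ... | yes u∈I | _ with member-onto u u∈I
    ...   | i , refl = inj₂ (i , y∈p∪⁅y⁆ (N u) u , N[x]⁺ e)
    edges u v e | no _ | yes v∈I with member-onto v v∈I
    ...   | i , refl = inj₂ (i , N[x]⁺ (Adj-sym u v e) , y∈p∪⁅y⁆ (N v) v)
    edges u v e | no u∉I | no v∉I = inj₁ (x∉p⇒x∈∁p u∉I , x∉p⇒x∈∁p v∉I)
    only-member : ∀ {v} i → v ∈ I → v ∈ N[ member i ] → v ≡ member i
    only-member {v} i v∈I v∈ with x∈p∪⁅y⁆⁻ (N (member i)) (member i) v∈
    ... | inj₁ v∈N    = contradiction (N⁻ v∈N) (independent (member i) v (member∈I i) v∈I)
    ... | inj₂ v≡member = v≡member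
    coherent : ∀ v i j → i ≢ j → v ∈ N[ member i ] → v ∈ N[ member j ] → v ∈ ∁ I
    coherent v i j i≢j v∈i v∈j with v ∈? I
    ... | no  v∉I = x∉p⇒x∈∁p v∉I
    ... | yes v∈I = contradiction
      (member-injective (trans (sym (only-member i v∈I v∈i)) (only-member j v∈I v∈j))) i≢j

  open StarDecomposition star public using (leaf)

  centre∩leaf⊆N : ∀ i → ∁ I ∩ leaf i ⊆ N (member i)
  centre∩leaf⊆N i w∈ with x∈p∩q⁻ (∁ I) (leaf i) w∈
  ... | w∈∁I , w∈leaf with x∈p∪⁅y⁆⁻ (N (member i)) (member i) w∈leaf
  ...   | inj₁ w∈N = w∈N
  ...   | inj₂ refl = contradiction (member∈I i) (x∈∁p⇒x∉p w∈∁I)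

  adhesion≤deg : ∀ i → ∣ ∁ I ∩ leaf i ∣ ≤ deg (member i)
  adhesion≤deg i = p⊆q⇒∣p∣≤∣q∣ (centre∩leaf⊆N i)

  ∣leaf∣≡1+deg : ∀ i → ∣ leaf i ∣ ≡ suc (deg (member i))
  ∣leaf∣≡1+deg i = ∣N[x]∣≡1+deg (member i)

  torso : SGraph order
  torso = centralTorso star

  torso-irreflexive : ∀ u → ¬ E torso u u
  torso-irreflexive u (inj₁ e)         = Adj-irrefl u e
  torso-irreflexive u (inj₂ (u≢u , _)) = u≢u refl

  torso-shortcut : ∀ {u x v} → u ∈ ∁ I → x ∈ I → v ∈ ∁ I → u ≢ v → Adj u x → Adj x v →
                   E torso u v
  torso-shortcut {u} {x} {v} u∈ x∈I v∈ u≢v ux xv with member-onto x x∈I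
  ... | i , refl =
    inj₂ (u≢v , i , x∈p∩q⁺ (u∈ , N[x]⁺ (Adj-sym u x ux)) , x∈p∩q⁺ (v∈ , N[x]⁺ xv))

  private
    ∈torso∖ : ∀ {X w} → w ∈ ∁ I → w ∈ V (toSG G ∖ X) → w ∈ V (torso ∖ X)
    ∈torso∖ {X} w∈ w∈G∖X = x∈p∧x∉q⇒x∈p─q w∈ (proj₂ (x∈p─q⁻ ⊤ X w∈G∖X))

  -- A walk leaving the centre enters some y ∈ I and, I being independent, returns at once;
  -- the detour through y is replaced by a torso edge.
  lift-walk : ∀ X {u v} → u ∈ ∁ I → v ∈ ∁ I → Walk (toSG G ∖ X) u v → Walk (torso ∖ X) u v
  lift-walk X u∈ v∈ (here u∈′) = here (∈torso∖ u∈ u∈′)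
  lift-walk X {u} u∈ v∈ (step {v = y} u∈′ e r) with y ∈? I
  ... | no y∉I = step (∈torso∖ u∈ u∈′) (inj₁ e) (lift-walk X (x∉p⇒x∈∁p y∉I) v∈ r)
  ... | yes y∈I with r
  ...   | here _ = contradiction y∈I (x∈∁p⇒x∉p v∈)
  ...   | step {v = y′} _ e′ r′ with y′ ∈? I
  ...     | yes y′∈I = contradiction e′ (independent y y′ y∈I y′∈I)
  ...     | no y′∉I with u ≟ y′
  ...       | yes refl = lift-walk X u∈ v∈ r′
  ...       | no u≢y′ = step (∈torso∖ u∈ u∈′)
                          (torso-shortcut u∈ y∈I (x∉p⇒x∈∁p y′∉I) u≢y′ e e′)
                          (lift-walk X (x∉p⇒x∈∁p y′∉I) v∈ r′)

  torso-no-small-separator : NoSeparatorSmallerThan k (toSG G) → NoSeparatorSmallerThan k torso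
  torso-no-small-separator unsep X _ ∣X∣<k u v u∈ v∈
    with x∈p─q⁻ (∁ I) X u∈ | x∈p─q⁻ (∁ I) X v∈
  ... | u∈∁I , u∉X | v∈∁I , v∉X =
    lift-walk X u∈∁I v∈∁I (unsep X ⊆⊤ ∣X∣<k u v (∉⇒∈G∖ u∉X) (∉⇒∈G∖ v∉X))

module DegreeThreeStar (G : Graph) (Q : Quasi4Connected (toSG G)) where
  open Neighbourhood G
  open QuasiFourConnected G Q
  open GreedyIndependentSet G (λ x → deg x ≟ℕ 3)
  open IndependentDominating (greedy (allFin order))
  open StarOfIndependentSet G I independent public

  adhesion-three : AdhesionThree star
  adhesion-three i = subst (∣ ∁ I ∩ leaf i ∣ ≤_) (I⊆P (member∈I i)) (adhesion≤deg i)

  leaves-have-four-vertices : ∀ i → ∣ leaf i ∣ ≡ 4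
  leaves-have-four-vertices i = trans (∣leaf∣≡1+deg i) (cong suc (I⊆P (member∈I i)))

  torso∖3-set-¬¬connected : ∀ S → S ⊆ ∁ I → ∣ S ∣ ≡ 3 → ¬ ¬ Connected (torso ∖ S)
  torso∖3-set-¬¬connected S S⊆∁I ∣S∣≡3 ¬connected = ¬¬-decidable (¬connected ∘ connected)
    where
    not-isolated : ∀ {z} → z ∈ ∁ I → ¬ (N z ⊆ S)
    not-isolated {z} z∈∁I N⊆S with dominates (∈-allFin z) (N⊆3-set⇒deg≡3 z ∣S∣≡3 N⊆S)
    ... | inj₁ z∈I             = x∈∁p⇒x∉p z∈∁I z∈I
    ... | inj₂ (y , y∈I , e) = x∈∁p⇒x∉p (S⊆∁I (N⊆S (N⁺ e))) y∈I
    connected : (∀ u w → Dec (Walk (toSG G ∖ S) u w)) → Connected (torso ∖ S)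
    connected reach? u v u∈ v∈ with x∈p─q⁻ (∁ I) S u∈ | x∈p─q⁻ (∁ I) S v∈ | reach? u v
    ... | u∈∁I , _    | v∈∁I , _    | yes r   = lift-walk S u∈∁I v∈∁I r
    ... | u∈∁I , u∉S | v∈∁I , v∉S | no u↛v =
      ⊥-elim ([ not-isolated u∈∁I , not-isolated v∈∁I ]′
                (3-separator-isolates ∣S∣≡3 u∉S v∉S (reach? u) u↛v))

  3≤∣∁I∣ : 3 ≤ ∣ ∁ I ∣
  3≤∣∁I∣ with any? (_∈? I)
  ... | yes (x , x∈I) = subst (_≤ ∣ ∁ I ∣) (I⊆P x∈I) (p⊆q⇒∣p∣≤∣q∣ N⊆∁I)
    where
    N⊆∁I : N x ⊆ ∁ I
    N⊆∁I w∈N = x∉p⇒x∈∁p λ w∈I → independent x _ x∈I w∈I (N⁻ w∈N)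
  ... | no I-empty = ≤-trans (s≤s (s≤s (s≤s z≤n)))
                             (≤-trans (proj₁ (proj₂ Q)) (p⊆q⇒∣p∣≤∣q∣ {p = ⊤} ⊤⊆∁I))
    where
    ⊤⊆∁I : ⊤ ⊆ ∁ I
    ⊤⊆∁I {w} _ = x∉p⇒x∈∁p λ w∈I → I-empty (w , w∈I)

  torso-no-2-separator : NoSeparatorSmallerThan 3 torso
  torso-no-2-separator = torso-no-small-separator (proj₂ (proj₁ Q))

  small-torso-complete : ∣ ∁ I ∣ ≤ 4 → ∣ ∁ I ∣ ≡ k → IsoToComplete k torso
  small-torso-complete ∣∁I∣≤4 ∣∁I∣≡k = complete⇒IsoToComplete ∣∁I∣≡k torso-irreflexive
    (no-small-separator⇒complete torso-no-2-separator ∣∁I∣≤4)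

  small-torso-K4-or-K3 : ∣ ∁ I ∣ ≤ 4 → IsoToComplete 4 torso ⊎ IsoToComplete 3 torso
  small-torso-K4-or-K3 ∣∁I∣≤4 with ∣ ∁ I ∣ ≟ℕ 3
  ... | yes ∣∁I∣≡3 = inj₂ (small-torso-complete ∣∁I∣≤4 ∣∁I∣≡3)
  ... | no  ∣∁I∣≢3 = inj₁ (small-torso-complete ∣∁I∣≤4
                             (≤-antisym ∣∁I∣≤4 (≤∧≢⇒< 3≤∣∁I∣ (∣∁I∣≢3 ∘ sym))))

  torso-classification :
    Internally4Connected torso ⊎ IsoToComplete 4 torso ⊎ IsoToComplete 3 torso
  torso-classification with 5 ≤? ∣ ∁ I ∣
  ... | no  5≰∣∁I∣ = inj₂ (small-torso-K4-or-K3 (≤-pred (≰⇒> 5≰∣∁I∣)))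
  ... | yes 5≤∣∁I∣ = inj₁ ((<⇒≤ 5≤∣∁I∣ , torso-no-2-separator) , 5≤∣∁I∣ ,
                          λ S S⊆∁I ∣S∣≡3 ¬connected →
                            ⊥-elim (torso∖3-set-¬¬connected S S⊆∁I ∣S∣≡3 ¬connected))

corollary3p12 : (G : Graph) → Quasi4Connected (toSG G) →
    Σ (StarDecomposition G) λ D →
      AdhesionThree D
      × (Internally4Connected (centralTorso D)
         ⊎ IsoToComplete 4 (centralTorso D) ⊎ IsoToComplete 3 (centralTorso D))
      × (∀ i → ∣ StarDecomposition.leaf D i ∣ ≡ 4)
corollary3p12 G Q = star , adhesion-three , torso-classification , leaves-have-four-vertices
  where open DegreeThreeStar G Q
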